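{- Let $K_6=\{(0,0),(0,1),(0,2),(1,0),(1,1),(2,0)\}\subseteq\mathbb{Z}^2$ and let $\varphi:K_6\to B$ be a Freiman isomorphism onto a set $B\subseteq\mathbb{Z}$. Call the elements of $\varphi(\{(0,2),(2,0),(0,0)\})$ the vertices of $\varphi(K_6)$. Then: \begin{enumerate} \item $\min B$ and $\max B$ are vertices of $\varphi(K_6)$; \item if $x,y\in B$ are vertices, then $\frac12(x+y)\in B$; \item if $B\subseteq[a,b]$ (integers $a\le b$), then $b-a\geqslant 10$; \item if $B\subseteq[0,10]$, then $B$ is one of $B_1=\{0,1,2,5,6,10\}$, $B_2=\{0,2,4,5,7,10\}$, $B_3=10-B_1$, $B_4=10-B_2$. \end{enumerate}
   Context: A bijection $\varphi:X\to Y$ between subsets of abelian semigroups is a Freiman isomorphism (of order 2) if for all $a,b,c,d\in X$: $a+b=c+d$ iff $\varphi(a)+\varphi(b)=\varphi(c)+\varphi(d)$. $[a,b]$ denotes the set of integers between $a$ and $b$ inclusive; $10-X=\{10-x:x\in X\}$. -}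

module Defs where

open import Data.Integer using (ℤ; +_; _+_; _-_; _≤_)
open import Data.Product using (_×_; _,_; Σ; ∃)
open import Data.Sum using (_⊎_)
open import Data.List using (List; []; _∷_; map)
open import Data.List.Membership.Propositional using (_∈_)
open import Relation.Binary.PropositionalEquality using (_≡_)
open import Function.Bundles using (_⇔_)
open import Function.Definitions using (Injective)

data K6 : Set where
  p00 p01 p02 p10 p11 p20 : K6

coord : K6 → ℤ × ℤ
coord p00 = (+ 0 , + 0)
coord p01 = (+ 0 , + 1)
coord p02 = (+ 0 , + 2)
coord p10 = (+ 1 , + 0)
coord p11 = (+ 1 , + 1)
coord p20 = (+ 2 , + 0)

_+²_ : ℤ × ℤ → ℤ × ℤ → ℤ × ℤ
(a , b) +² (c , d) = (a + c , b + d)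

-- φ : K₆ → ℤ is a Freiman isomorphism (of order 2) onto its image B = φ(K₆):
-- injective (hence a bijection onto the image) and
-- a+b=c+d iff φ(a)+φ(b)=φ(c)+φ(d).
record IsFreimanIso (φ : K6 → ℤ) : Set where
  field
    injective : Injective _≡_ _≡_ φ
    freiman : ∀ a b c d →
      (coord a +² coord b ≡ coord c +² coord d) ⇔ (φ a + φ b ≡ φ c + φ d)

_∈B[_] : ℤ → (K6 → ℤ) → Set
x ∈B[ φ ] = ∃ λ k → φ k ≡ x

IsVertex : K6 → Set
IsVertex k = (k ≡ p02) ⊎ (k ≡ p20) ⊎ (k ≡ p00)

ImageIs : (K6 → ℤ) → List ℤ → Set
ImageIs φ L = (∀ k → φ k ∈ L) × (∀ x → x ∈ L → x ∈B[ φ ])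

B₁ B₂ B₃ B₄ : List ℤ
B₁ = + 0 ∷ + 1 ∷ + 2 ∷ + 5 ∷ + 6 ∷ + 10 ∷ []
B₂ = + 0 ∷ + 2 ∷ + 4 ∷ + 5 ∷ + 7 ∷ + 10 ∷ []
B₃ = map (λ x → + 10 - x) B₁
B₄ = map (λ x → + 10 - x) B₂

-- A Freiman isomorphism on K₆ preserves the relations (1,0)+(1,0) = (0,0)+(2,0) and the like, so it
-- is the restriction of an affine map and each non-vertex value is the midpoint of two vertex values;
-- this gives (1) and (2). If B ⊆ [0,10], the values at (0,0), (1,0), (0,1) lie in [0,10] and determine
-- φ, and an exhaustive check of the 11³ candidates leaves exactly B₁, …, B₄. Each of these contains 10,
-- so translating B ⊆ [a,b] with b − a < 10 into [0,10] yields a contradiction, which gives (3).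
module Submission where

open import Defs
open import Data.Integer using (ℤ; +_; -_; _+_; _-_; _≤_; _<_; +≤+; _≟_; _≤?_)
import Data.Integer.Properties as ℤ
open import Algebra.Properties.AbelianGroup ℤ.+-0-abelianGroup using (∙-cancelʳ; x≈z//y)
open import Algebra.Properties.CommutativeSemigroup ℤ.+-commutativeSemigroup using (interchange)
open import Data.List using (List; []; _∷_; map; upTo)
open import Data.List.Extrema ℤ.≤-totalOrder
  using (argmin; argmax; argmin-all; argmax-all; f[argmin]≤f[⊤]; f[argmin]≤f[xs]; f[⊥]≤f[argmax]; f[xs]≤f[argmax])
open import Data.List.Membership.Propositional using (_∈_)
open import Data.List.Membership.Propositional.Properties using (∈-map⁺; ∈-upTo⁺)
open import Data.List.Membership.DecPropositional _≟_ using (_∈?_)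
open import Data.List.Relation.Unary.All as All using (All; []; _∷_; all?)
open import Data.List.Relation.Unary.Any as Any using (here; there; any?)
open import Data.Nat using (s≤s)
open import Data.Product using (_×_; _,_; ∃; proj₁; proj₂; uncurry)
open import Data.Product.Properties using (≡-dec)
open import Data.Sum as Sum using (_⊎_; inj₁; inj₂)
open import Function using (_∘_)
open import Function.Bundles using (Equivalence; mk⇔)
open import Relation.Binary.PropositionalEquality using (_≡_; _≗_; refl; sym; trans; cong; subst; module ≡-Reasoning)
open import Relation.Nullary using (Dec)
open import Relation.Nullary.Decidable using (map′; _×-dec_; _⊎-dec_; _→-dec_; from-yes)
open import Relation.Unary using (Decidable)

ImageWithin : ℤ → ℤ → (K6 → ℤ) → Set
ImageWithin a b φ = ∀ k → a ≤ φ k × φ k ≤ b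

ImageAmongB : (K6 → ℤ) → Set
ImageAmongB φ = ImageIs φ B₁ ⊎ ImageIs φ B₂ ⊎ ImageIs φ B₃ ⊎ ImageIs φ B₄

ReflectsSums : (K6 → ℤ) → Set
ReflectsSums φ = ∀ a b c d → φ a + φ b ≡ φ c + φ d → coord a +² coord b ≡ coord c +² coord d

≤-midpoint : ∀ {m x y z} → m ≤ y → m ≤ z → x + x ≡ y + z → m ≤ x
≤-midpoint m≤y m≤z x+x≡y+z = ℤ.≮⇒≥ λ x<m →
  ℤ.<⇒≱ (ℤ.+-mono-< x<m x<m) (subst (_ ≤_) (sym x+x≡y+z) (ℤ.+-mono-≤ m≤y m≤z))

midpoint-≤ : ∀ {M x y z} → y ≤ M → z ≤ M → x + x ≡ y + z → x ≤ M
midpoint-≤ y≤M z≤M x+x≡y+z = ℤ.≮⇒≥ λ M<x →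
  ℤ.<⇒≱ (ℤ.+-mono-< M<x M<x) (subst (_≤ _) (sym x+x≡y+z) (ℤ.+-mono-≤ y≤M z≤M))

vertex-elim : ∀ {P : K6 → Set} → P p02 → P p20 → P p00 → ∀ {v} → IsVertex v → P v
vertex-elim p q r (inj₁ refl)        = p
vertex-elim p q r (inj₂ (inj₁ refl)) = q
vertex-elim p q r (inj₂ (inj₂ refl)) = r

vertex-midpoint : ∀ {u v} → IsVertex u → IsVertex v → ∃ λ k → coord k +² coord k ≡ coord u +² coord v
vertex-midpoint (inj₁ refl)        (inj₁ refl)        = p02 , refl
vertex-midpoint (inj₁ refl)        (inj₂ (inj₁ refl)) = p11 , refl
vertex-midpoint (inj₁ refl)        (inj₂ (inj₂ refl)) = p01 , refl
vertex-midpoint (inj₂ (inj₁ refl)) (inj₁ refl)        = p11 , refl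
vertex-midpoint (inj₂ (inj₁ refl)) (inj₂ (inj₁ refl)) = p20 , refl
vertex-midpoint (inj₂ (inj₁ refl)) (inj₂ (inj₂ refl)) = p10 , refl
vertex-midpoint (inj₂ (inj₂ refl)) (inj₁ refl)        = p01 , refl
vertex-midpoint (inj₂ (inj₂ refl)) (inj₂ (inj₁ refl)) = p10 , refl
vertex-midpoint (inj₂ (inj₂ refl)) (inj₂ (inj₂ refl)) = p00 , refl

least-vertex : (f : K6 → ℤ) → ∃ λ v → IsVertex v × (∀ {w} → IsVertex w → f v ≤ f w)
least-vertex f with f[argmin]≤f[xs] {f = f} p00 (p02 ∷ p20 ∷ [])
... | ≤p02 ∷ ≤p20 ∷ [] =
  v , argmin-all f {P = IsVertex} (inj₂ (inj₂ refl)) (inj₁ refl ∷ inj₂ (inj₁ refl) ∷ []) ,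
  vertex-elim {P = λ w → f v ≤ f w} ≤p02 ≤p20 (f[argmin]≤f[⊤] {f = f} p00 (p02 ∷ p20 ∷ []))
  where v = argmin f p00 (p02 ∷ p20 ∷ [])

greatest-vertex : (f : K6 → ℤ) → ∃ λ v → IsVertex v × (∀ {w} → IsVertex w → f w ≤ f v)
greatest-vertex f with f[xs]≤f[argmax] {f = f} p00 (p02 ∷ p20 ∷ [])
... | p02≤ ∷ p20≤ ∷ [] =
  v , argmax-all f {P = IsVertex} (inj₂ (inj₂ refl)) (inj₁ refl ∷ inj₂ (inj₁ refl) ∷ []) ,
  vertex-elim {P = λ w → f w ≤ f v} p02≤ p20≤ (f[⊥]≤f[argmax] {f = f} p00 (p02 ∷ p20 ∷ []))
  where v = argmax f p00 (p02 ∷ p20 ∷ [])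

-- The restriction to K₆ of (i , j) ↦ x + i (y − x) + j (z − x).
affine : ℤ → ℤ → ℤ → K6 → ℤ
affine x y z p00 = x
affine x y z p10 = y
affine x y z p01 = z
affine x y z p20 = y + y - x
affine x y z p11 = y + z - x
affine x y z p02 = z + z - x

module FreimanIso {φ : K6 → ℤ} (iso : IsFreimanIso φ) where
  open IsFreimanIso iso

  preserves : ∀ a b c d → coord a +² coord b ≡ coord c +² coord d → φ a + φ b ≡ φ c + φ d
  preserves a b c d = Equivalence.to (freiman a b c d)

  reflects : ReflectsSums φ
  reflects a b c d = Equivalence.from (freiman a b c d)

  vertices-bound-below : ∀ {m} → (∀ {v} → IsVertex v → m ≤ φ v) → ∀ k → m ≤ φ k
  vertices-bound-below m≤ p00 = m≤ (inj₂ (inj₂ refl))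
  vertices-bound-below m≤ p20 = m≤ (inj₂ (inj₁ refl))
  vertices-bound-below m≤ p02 = m≤ (inj₁ refl)
  vertices-bound-below m≤ p10 = ≤-midpoint (m≤ (inj₂ (inj₂ refl))) (m≤ (inj₂ (inj₁ refl))) (preserves p10 p10 p00 p20 refl)
  vertices-bound-below m≤ p01 = ≤-midpoint (m≤ (inj₂ (inj₂ refl))) (m≤ (inj₁ refl)) (preserves p01 p01 p00 p02 refl)
  vertices-bound-below m≤ p11 = ≤-midpoint (m≤ (inj₂ (inj₁ refl))) (m≤ (inj₁ refl)) (preserves p11 p11 p20 p02 refl)

  vertices-bound-above : ∀ {M} → (∀ {v} → IsVertex v → φ v ≤ M) → ∀ k → φ k ≤ M
  vertices-bound-above ≤M p00 = ≤M (inj₂ (inj₂ refl))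
  vertices-bound-above ≤M p20 = ≤M (inj₂ (inj₁ refl))
  vertices-bound-above ≤M p02 = ≤M (inj₁ refl)
  vertices-bound-above ≤M p10 = midpoint-≤ (≤M (inj₂ (inj₂ refl))) (≤M (inj₂ (inj₁ refl))) (preserves p10 p10 p00 p20 refl)
  vertices-bound-above ≤M p01 = midpoint-≤ (≤M (inj₂ (inj₂ refl))) (≤M (inj₁ refl)) (preserves p01 p01 p00 p02 refl)
  vertices-bound-above ≤M p11 = midpoint-≤ (≤M (inj₂ (inj₁ refl))) (≤M (inj₁ refl)) (preserves p11 p11 p20 p02 refl)

  minimum-at-vertex : ∃ λ v → IsVertex v × (∀ k → φ v ≤ φ k)
  minimum-at-vertex with least-vertex φ
  ... | v , vertex , least = v , vertex , vertices-bound-below least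

  maximum-at-vertex : ∃ λ v → IsVertex v × (∀ k → φ k ≤ φ v)
  maximum-at-vertex with greatest-vertex φ
  ... | v , vertex , greatest = v , vertex , vertices-bound-above greatest

  vertex-midpoint∈B : ∀ u v → IsVertex u → IsVertex v → ∃ λ k → φ k + φ k ≡ φ u + φ v
  vertex-midpoint∈B u v vu vv with vertex-midpoint vu vv
  ... | k , 2k≡u+v = k , preserves k k u v 2k≡u+v

  φ≗affine : φ ≗ affine (φ p00) (φ p10) (φ p01)
  φ≗affine p00 = refl
  φ≗affine p10 = refl
  φ≗affine p01 = refl
  φ≗affine p20 = x≈z//y (φ p20) (φ p00) _ (preserves p20 p00 p10 p10 refl)
  φ≗affine p11 = x≈z//y (φ p11) (φ p00) _ (preserves p11 p00 p10 p01 refl)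
  φ≗affine p02 = x≈z//y (φ p02) (φ p00) _ (preserves p02 p00 p01 p01 refl)

translate-freimanIso : ∀ {φ} t → IsFreimanIso φ → IsFreimanIso (λ k → φ k + t)
translate-freimanIso {φ} t iso = record
  { injective = λ {k} {l} → injective ∘ ∙-cancelʳ t (φ k) (φ l)
  ; freiman = λ a b c d → mk⇔
      (λ same → translated (φ a) (φ b) (φ c) (φ d) (Equivalence.to (freiman a b c d) same))
      (λ same → Equivalence.from (freiman a b c d) (untranslated (φ a) (φ b) (φ c) (φ d) same))
  }
  where
  open IsFreimanIso iso
  translated : ∀ a b c d → a + b ≡ c + d → (a + t) + (b + t) ≡ (c + t) + (d + t)
  translated a b c d eq = begin
    (a + t) + (b + t) ≡⟨ interchange a t b t ⟩
    (a + b) + (t + t) ≡⟨ cong (_+ (t + t)) eq ⟩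
    (c + d) + (t + t) ≡⟨ interchange c d t t ⟩
    (c + t) + (d + t) ∎
    where open ≡-Reasoning
  untranslated : ∀ a b c d → (a + t) + (b + t) ≡ (c + t) + (d + t) → a + b ≡ c + d
  untranslated a b c d eq = ∙-cancelʳ (t + t) (a + b) (c + d)
    (trans (interchange a b t t) (trans eq (interchange c t d t)))

allK6 : List K6
allK6 = p00 ∷ p01 ∷ p02 ∷ p10 ∷ p11 ∷ p20 ∷ []

∈-allK6 : ∀ k → k ∈ allK6
∈-allK6 p00 = here refl
∈-allK6 p01 = there (here refl)
∈-allK6 p02 = there (there (here refl))
∈-allK6 p10 = there (there (there (here refl)))
∈-allK6 p11 = there (there (there (there (here refl))))
∈-allK6 p20 = there (there (there (there (there (here refl)))))

∀-K6? : ∀ {P : K6 → Set} → Decidable P → Dec (∀ k → P k)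
∀-K6? P? = map′ (λ all k → All.lookup all (∈-allK6 k)) (λ all → All.tabulate (λ {k} _ → all k)) (all? P? allK6)

∃-K6? : ∀ {P : K6 → Set} → Decidable P → Dec (∃ P)
∃-K6? P? = map′ Any.satisfied (λ (k , pk) → Any.map (λ { refl → pk }) (∈-allK6 k)) (any? P? allK6)

imageWithin? : ∀ a b φ → Dec (ImageWithin a b φ)
imageWithin? a b φ = ∀-K6? λ k → (a ≤? φ k) ×-dec (φ k ≤? b)

reflectsSums? : ∀ φ → Dec (ReflectsSums φ)
reflectsSums? φ = ∀-K6? λ a → ∀-K6? λ b → ∀-K6? λ c → ∀-K6? λ d →
  (φ a + φ b ≟ φ c + φ d) →-dec ≡-dec _≟_ _≟_ (coord a +² coord b) (coord c +² coord d)

imageIs? : ∀ φ L → Dec (ImageIs φ L)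
imageIs? φ L = (∀-K6? λ k → φ k ∈? L) ×-dec
  map′ (λ all x → All.lookup all) (λ all → All.tabulate (all _)) (all? (λ x → ∃-K6? λ k → φ k ≟ x) L)

imageAmongB? : ∀ φ → Dec (ImageAmongB φ)
imageAmongB? φ = imageIs? φ B₁ ⊎-dec imageIs? φ B₂ ⊎-dec imageIs? φ B₃ ⊎-dec imageIs? φ B₄

zeroToTen : List ℤ
zeroToTen = map +_ (upTo 11)

∈-zeroToTen : ∀ {i} → + 0 ≤ i → i ≤ + 10 → i ∈ zeroToTen
∈-zeroToTen (+≤+ _) (+≤+ n≤10) = ∈-map⁺ +_ (∈-upTo⁺ (s≤s n≤10))

AffineClassified : ℤ → ℤ → ℤ → Set
AffineClassified x y z =
  ImageWithin (+ 0) (+ 10) (affine x y z) → ReflectsSums (affine x y z) → ImageAmongB (affine x y z)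

affine-classified : ∀ {x y z} → x ∈ zeroToTen → y ∈ zeroToTen → z ∈ zeroToTen → AffineClassified x y z
affine-classified x∈ y∈ z∈ = All.lookup (All.lookup (All.lookup table x∈) y∈) z∈
  where
  classified? : ∀ x y z → Dec (AffineClassified x y z)
  classified? x y z = imageWithin? (+ 0) (+ 10) (affine x y z) →-dec (reflectsSums? (affine x y z) →-dec imageAmongB? (affine x y z))
  -- Since _→-dec_ short-circuits, only bounded candidates reach the 6⁴ sum comparisons.
  table : All (λ x → All (λ y → All (AffineClassified x y) zeroToTen) zeroToTen) zeroToTen
  table = from-yes (all? (λ x → all? (λ y → all? (classified? x y) zeroToTen) zeroToTen) zeroToTen)

ImageWithin-resp-≗ : ∀ {a b φ ψ} → φ ≗ ψ → ImageWithin a b φ → ImageWithin a b ψ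
ImageWithin-resp-≗ φ≗ψ within k rewrite sym (φ≗ψ k) = within k

ReflectsSums-resp-≗ : ∀ {φ ψ} → φ ≗ ψ → ReflectsSums φ → ReflectsSums ψ
ReflectsSums-resp-≗ φ≗ψ reflects a b c d rewrite sym (φ≗ψ a) | sym (φ≗ψ b) | sym (φ≗ψ c) | sym (φ≗ψ d) =
  reflects a b c d

ImageIs-resp-≗ : ∀ {φ ψ L} → φ ≗ ψ → ImageIs φ L → ImageIs ψ L
ImageIs-resp-≗ {L = L} φ≗ψ (φ⊆L , L⊆φ) =
  (λ k → subst (_∈ L) (φ≗ψ k) (φ⊆L k)) ,
  (λ x x∈L → let (k , φk≡x) = L⊆φ x x∈L in k , trans (sym (φ≗ψ k)) φk≡x)

ImageAmongB-resp-≗ : ∀ {φ ψ} → φ ≗ ψ → ImageAmongB φ → ImageAmongB ψ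
ImageAmongB-resp-≗ φ≗ψ =
  Sum.map (ImageIs-resp-≗ φ≗ψ) (Sum.map (ImageIs-resp-≗ φ≗ψ) (Sum.map (ImageIs-resp-≗ φ≗ψ) (ImageIs-resp-≗ φ≗ψ)))

classification : ∀ {φ} → IsFreimanIso φ → ImageWithin (+ 0) (+ 10) φ → ImageAmongB φ
classification {φ} iso within =
  ImageAmongB-resp-≗ (sym ∘ φ≗affine)
    (affine-classified (in-range p00) (in-range p10) (in-range p01)
      (ImageWithin-resp-≗ φ≗affine within) (ReflectsSums-resp-≗ φ≗affine reflects))
  where
  open FreimanIso iso
  in-range : ∀ k → φ k ∈ zeroToTen
  in-range k = uncurry ∈-zeroToTen (within k)

ImageAmongB⇒10∈B : ∀ {φ} → ImageAmongB φ → (+ 10) ∈B[ φ ]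
ImageAmongB⇒10∈B (inj₁ (_ , B₁⊆φ))               = B₁⊆φ (+ 10) (there (there (there (there (there (here refl))))))
ImageAmongB⇒10∈B (inj₂ (inj₁ (_ , B₂⊆φ)))        = B₂⊆φ (+ 10) (there (there (there (there (there (here refl))))))
ImageAmongB⇒10∈B (inj₂ (inj₂ (inj₁ (_ , B₃⊆φ)))) = B₃⊆φ (+ 10) (here refl)
ImageAmongB⇒10∈B (inj₂ (inj₂ (inj₂ (_ , B₄⊆φ)))) = B₄⊆φ (+ 10) (here refl)

width≥10 : ∀ {φ a b} → IsFreimanIso φ → ImageWithin a b φ → + 10 ≤ b - a
width≥10 {φ} {a} {b} iso within = ℤ.≮⇒≥ λ narrow →
  let (k , ψk≡10) = ImageAmongB⇒10∈B (classification (translate-freimanIso (- a) iso) (within₀₁₀ narrow))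
  in ℤ.<⇒≱ narrow (subst (_≤ b - a) ψk≡10 (proj₂ (within₀ k)))
  where
  within₀ : ImageWithin (+ 0) (b - a) (λ k → φ k - a)
  within₀ k = ℤ.i≤j⇒0≤j-i (proj₁ (within k)) , ℤ.+-monoˡ-≤ (- a) (proj₂ (within k))
  within₀₁₀ : b - a < + 10 → ImageWithin (+ 0) (+ 10) (λ k → φ k - a)
  within₀₁₀ narrow k = proj₁ (within₀ k) , ℤ.<⇒≤ (ℤ.≤-<-trans (proj₂ (within₀ k)) narrow)

proposition1p2 : (φ : K6 → ℤ) → IsFreimanIso φ →
    -- (1) min B and max B are vertices
    ((∃ λ v → IsVertex v × (∀ k → φ v ≤ φ k))
      × (∃ λ v → IsVertex v × (∀ k → φ k ≤ φ v)))
    -- (2) if x, y are vertices then (x+y)/2 ∈ B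
    × (∀ u v → IsVertex u → IsVertex v → ∃ λ k → φ k + φ k ≡ φ u + φ v)
    -- (3) B ⊆ [a,b] implies b - a ≥ 10
    × (∀ a b → a ≤ b → (∀ k → a ≤ φ k × φ k ≤ b) → + 10 ≤ b - a)
    -- (4) B ⊆ [0,10] implies B ∈ {B₁, B₂, B₃, B₄}
    × ((∀ k → + 0 ≤ φ k × φ k ≤ + 10) →
        ImageIs φ B₁ ⊎ ImageIs φ B₂ ⊎ ImageIs φ B₃ ⊎ ImageIs φ B₄)
proposition1p2 φ iso =
  (minimum-at-vertex , maximum-at-vertex) ,
  vertex-midpoint∈B ,
  (λ _ _ _ → width≥10 iso) ,
  classification iso
  where open FreimanIso iso
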